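{- Let $G$ be a connected $(P_5,\text{paw})$-free graph. Then $cop(G)\leq 2$.
   Context: All graphs are finite, simple and undirected. $P_n$ denotes the path on $n$ vertices. The paw is the graph on vertices $v_1,v_2,v_3,v_4$ with edges $v_1v_2,v_2v_3,v_3v_4,v_2v_4$ (a triangle with a pendant vertex). A graph is $(H_1,\dots,H_k)$-free if it contains no induced subgraph isomorphic to any $H_i$. Game of cops and robber on a connected graph: first all cops are placed on vertices (several may share a vertex), then the robber chooses a vertex; afterwards cops and robber move alternately, starting with the cops, where a move consists of staying put or moving to an adjacent vertex. The cops win if after finitely many rounds some cop is on the same vertex as the robber. The cop number $cop(G)$ is the minimum number of cops that guarantees a win in each connected component of $G$. -}

module Defs where

open import Data.Nat using (ℕ; zero; suc; _≡ᵇ_)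
open import Data.Bool using (Bool; true; false; T; _∨_)
open import Data.Bool.Properties using (∨-comm)
open import Data.Fin using (Fin; toℕ; zero; suc)
open import Data.Product using (Σ; ∃; ∃-syntax; _×_; _,_)
open import Data.Sum using (_⊎_)
open import Function.Definitions using (Injective)
open import Relation.Binary.PropositionalEquality using (_≡_; refl)
open import Relation.Nullary using (¬_)

record Graph (n : ℕ) : Set where
  field
    adj    : Fin n → Fin n → Bool
    sym    : ∀ i j → adj i j ≡ adj j i
    irrefl : ∀ i → adj i i ≡ false

  E : Fin n → Fin n → Set
  E i j = T (adj i j)

open Graph public

data Walk {n : ℕ} (G : Graph n) : Fin n → Fin n → Set where
  here : ∀ {u} → Walk G u u
  step : ∀ {u v w} → E G u v → Walk G v w → Walk G u w

Connected : ∀ {n} → Graph n → Set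
Connected G = ∀ u v → Walk G u v

InducedSubgraph : ∀ {m n} → Graph m → Graph n → Set
InducedSubgraph {m} {n} H G =
  Σ (Fin m → Fin n) λ f →
    Injective _≡_ _≡_ f × (∀ i j → adj H i j ≡ adj G (f i) (f j))

Free : ∀ {m n} → Graph m → Graph n → Set
Free H G = ¬ InducedSubgraph H G

private
  suc≢ᵇ : ∀ m → (suc m ≡ᵇ m) ≡ false
  suc≢ᵇ zero    = refl
  suc≢ᵇ (suc m) = suc≢ᵇ m

pathAdj : ∀ k → Fin k → Fin k → Bool
pathAdj k i j = (suc (toℕ i) ≡ᵇ toℕ j) ∨ (suc (toℕ j) ≡ᵇ toℕ i)

P : (k : ℕ) → Graph k
P k = record
  { adj    = pathAdj k
  ; sym    = λ i j → ∨-comm (suc (toℕ i) ≡ᵇ toℕ j) (suc (toℕ j) ≡ᵇ toℕ i)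
  ; irrefl = λ i → irr (toℕ i)
  }
  where
  irr : ∀ m → ((suc m ≡ᵇ m) ∨ (suc m ≡ᵇ m)) ≡ false
  irr m rewrite suc≢ᵇ m = refl

pattern v1 = zero
pattern v2 = suc zero
pattern v3 = suc (suc zero)
pattern v4 = suc (suc (suc zero))

pawAdj : Fin 4 → Fin 4 → Bool
pawAdj v1 v1 = false
pawAdj v1 v2 = true
pawAdj v1 v3 = false
pawAdj v1 v4 = false
pawAdj v2 v1 = true
pawAdj v2 v2 = false
pawAdj v2 v3 = true
pawAdj v2 v4 = true
pawAdj v3 v1 = false
pawAdj v3 v2 = true
pawAdj v3 v3 = false
pawAdj v3 v4 = true
pawAdj v4 v1 = false
pawAdj v4 v2 = true
pawAdj v4 v3 = true
pawAdj v4 v4 = false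

pawSym : ∀ i j → pawAdj i j ≡ pawAdj j i
pawSym v1 v1 = refl
pawSym v1 v2 = refl
pawSym v1 v3 = refl
pawSym v1 v4 = refl
pawSym v2 v1 = refl
pawSym v2 v2 = refl
pawSym v2 v3 = refl
pawSym v2 v4 = refl
pawSym v3 v1 = refl
pawSym v3 v2 = refl
pawSym v3 v3 = refl
pawSym v3 v4 = refl
pawSym v4 v1 = refl
pawSym v4 v2 = refl
pawSym v4 v3 = refl
pawSym v4 v4 = refl

pawIrrefl : ∀ i → pawAdj i i ≡ false
pawIrrefl v1 = refl
pawIrrefl v2 = refl
pawIrrefl v3 = refl
pawIrrefl v4 = refl

Paw : Graph 4
Paw = record { adj = pawAdj ; sym = pawSym ; irrefl = pawIrrefl }

Move : ∀ {n} → Graph n → Fin n → Fin n → Set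
Move G u v = u ≡ v ⊎ E G u v

Cops : ℕ → ℕ → Set
Cops k n = Fin k → Fin n

Caught : ∀ {k n} → Cops k n → Fin n → Set
Caught {k} c r = ∃[ i ] c i ≡ r

CopsMove : ∀ {k n} → Graph n → Cops k n → Cops k n → Set
CopsMove G c c' = ∀ i → Move G (c i) (c' i)

-- CopsForceWin G c r : cops at c, robber at r, cops to move, and the cops
-- have a strategy guaranteeing capture after finitely many rounds
-- (inductive = well-founded game tree; every play is finite).
data CopsForceWin {k n : ℕ} (G : Graph n) (c : Cops k n) (r : Fin n) : Set where
  move : (c' : Cops k n) → CopsMove G c c' →
         (Caught c' r ⊎
          (∀ r' → Move G r r' → Caught c' r' ⊎ CopsForceWin G c' r')) →
         CopsForceWin G c r

CopsWin : ∀ {n} → Graph n → ℕ → Set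
CopsWin {n} G k =
  Σ (Cops k n) λ c → ∀ r → Caught c r ⊎ CopsForceWin G c r

-- If G has a triangle, paw-freeness forces every vertex outside the closed
-- neighbourhood of a triangle vertex x to be adjacent to both other triangle
-- vertices, so x and one of them dominate G.  If G is triangle-free, take x of
-- maximum degree; P5-freeness and the degree bound put every vertex within
-- distance two of x.  An edge between two non-neighbours of x then closes an
-- induced C5, and every vertex is adjacent to two opposite vertices w i and
-- w (i+2) of that C5; two cops on w 0 and w 2 catch the robber in two rounds.
-- Otherwise x together with a neighbour y of maximum degree dominates G.
module Submission where

open import Defs
open import Data.Bool using (Bool; true; false; T)
import Data.Bool.Properties as Bool
open import Data.Empty using (⊥; ⊥-elim)
open import Data.Fin using (Fin; suc; _<_)
open import Data.Fin.Patterns using (0F; 1F; 2F; 3F; 4F)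
open import Data.Fin.Properties using (any?; all?; _≟_; <-cmp)
open import Data.Fin.Subset using (Subset; _∈_; _⊂_; ∣_∣)
open import Data.Fin.Subset.Properties using (p⊂q⇒∣p∣<∣q∣)
open import Data.List using (List; filter; allFin)
open import Data.List.Extrema.Nat using (argmax; argmax-all; f[xs]≤f[argmax])
open import Data.List.Membership.Propositional.Properties using (∈-allFin; ∈-filter⁺)
import Data.List.Relation.Unary.All as All
open import Data.List.Relation.Unary.All.Properties using (all-filter)
open import Data.Nat using (ℕ; zero; suc; _+_; _≤_; z≤n; s≤s)
open import Data.Nat.Properties using (≤⇒≯)
open import Data.Product using (Σ; ∃-syntax; _×_; _,_)
open import Data.Sum using (_⊎_; inj₁; inj₂)
open import Data.Unit using (tt)
open import Data.Vec using ([]; _∷_; lookup; tabulate)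
open import Data.Vec.Properties using (lookup∘tabulate; []=⇒lookup; lookup⇒[]=)
open import Function using (_∘_; _⇔_; Equivalence; mk⇔)
open import Function.Definitions using (Injective)
open import Relation.Binary using (tri<; tri≈; tri>)
open import Relation.Binary.PropositionalEquality as ≡ using (_≡_; _≢_; refl; trans; cong; subst)
open import Relation.Nullary using (¬_; Dec; yes; no)
open import Relation.Nullary.Decidable using (toWitness; _×-dec_; _⊎-dec_; ¬?; T?)
open import Level using (0ℓ)
open import Relation.Unary using (Pred; Decidable)
open import Relation.Unary.Properties using (U?)

open Equivalence using (to; from)

TwinFree : ∀ {m} → Graph m → Set
TwinFree {m} H = ∀ (i j : Fin m) → i ≡ j ⊎ ∃[ k ] adj H i k ≢ adj H j k

twinFree? : ∀ {m} (H : Graph m) → Dec (TwinFree H)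
twinFree? H = all? λ i → all? λ j → i ≟ j ⊎-dec any? λ k → ¬? (adj H i k Bool.≟ adj H j k)

IsEmbedding : ∀ {m n} → Graph m → Graph n → (Fin m → Fin n) → Set
IsEmbedding H G f = ∀ i j → adj H i j ≡ adj G (f i) (f j)

embedding-injective : ∀ {m n} {H : Graph m} {G : Graph n} {f : Fin m → Fin n} →
  TwinFree H → IsEmbedding H G f → Injective _≡_ _≡_ f
embedding-injective {H = H} {G} {f} twinFree embedding {i} {j} fi≡fj with twinFree i j
... | inj₁ i≡j = i≡j
... | inj₂ (k , differ) = ⊥-elim (differ (trans (embedding i k)
        (trans (cong (λ v → adj G v (f k)) fi≡fj) (≡.sym (embedding j k)))))

-- Realises b c witnesses c ≡ b as T c or ¬ T c, so that the hypotheses of an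
-- embedding read as adjacencies and non-adjacencies of G.
Realises : Bool → Bool → Set
Realises true  c = T c
Realises false c = ¬ T c

realises⇒≡ : ∀ b c → Realises b c → b ≡ c
realises⇒≡ true  true  _ = refl
realises⇒≡ true  false ()
realises⇒≡ false true  h = ⊥-elim (h tt)
realises⇒≡ false false _ = refl

induced : ∀ {m n} {H : Graph m} {G : Graph n} → TwinFree H → (f : Fin m → Fin n) →
  (∀ {i j} → i < j → Realises (adj H i j) (adj G (f i) (f j))) → InducedSubgraph H G
induced {H = H} {G} twinFree f upper =
  f , embedding-injective {H = H} {G = G} {f = f} twinFree embedding , embedding
  where
  embedding : IsEmbedding H G f
  embedding i j with <-cmp i j
  ... | tri< i<j _ _  = realises⇒≡ _ _ (upper i<j)
  ... | tri≈ _ refl _ = trans (irrefl H i) (≡.sym (irrefl G (f i)))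
  ... | tri> _ _ j<i  = trans (sym H i j) (trans (realises⇒≡ _ _ (upper j<i)) (sym G (f j) (f i)))

twinFree-P5 : TwinFree (P 5)
twinFree-P5 = toWitness {a? = twinFree? (P 5)} tt

twinFree-Paw : TwinFree Paw
twinFree-Paw = toWitness {a? = twinFree? Paw} tt

maximiser : ∀ {n} (f : Fin n → ℕ) {Q : Pred (Fin n) 0ℓ} → Decidable Q → ∀ {a} → Q a →
  ∃[ b ] Q b × (∀ c → Q c → f c ≤ f b)
maximiser {n} f Q? {a} Qa =
  argmax f a candidates ,
  argmax-all f Qa (all-filter Q? (allFin n)) ,
  λ c Qc → All.lookup (f[xs]≤f[argmax] a candidates) (∈-filter⁺ Q? (∈-allFin c) Qc)
  where
  candidates : List (Fin n)
  candidates = filter Q? (allFin n)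

suc₅ : Fin 5 → Fin 5
suc₅ 0F = 1F
suc₅ 1F = 2F
suc₅ 2F = 3F
suc₅ 3F = 4F
suc₅ 4F = 0F

-- Recursion on the ℕ offset makes positions such as (i ⊕ 3) ⊕ 2 and i ⊕ 5 on
-- a 5-cycle definitionally equal; only the wrap-around i ⊕ 5 ≡ i needs proof.
infixl 6 _⊕_
_⊕_ : Fin 5 → ℕ → Fin 5
i ⊕ zero  = i
i ⊕ suc k = suc₅ (i ⊕ k)

⊕-period : ∀ i k → i ⊕ (5 + k) ≡ i ⊕ k
⊕-period i k = period (i ⊕ k)
  where
  period : ∀ j → j ⊕ 5 ≡ j
  period 0F = refl
  period 1F = refl
  period 2F = refl
  period 3F = refl
  period 4F = refl

module _ {n : ℕ} (G : Graph n) where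

  infix 4 _~_
  _~_ : Fin n → Fin n → Set
  u ~ v = E G u v

  ~-sym : ∀ {u v} → u ~ v → v ~ u
  ~-sym {u} {v} = subst T (sym G u v)

  ≁-sym : ∀ {u v} → ¬ u ~ v → ¬ v ~ u
  ≁-sym u≁v = u≁v ∘ ~-sym

  _~?_ : ∀ u v → Dec (u ~ v)
  u ~? v = T? (adj G u v)

  TriangleFree : Set
  TriangleFree = ∀ {a b c} → a ~ b → b ~ c → a ~ c → ⊥

  no-induced-P5 : Free (P 5) G → ∀ {a b c d e} → a ~ b → b ~ c → c ~ d → d ~ e →
    ¬ a ~ c → ¬ a ~ d → ¬ a ~ e → ¬ b ~ d → ¬ b ~ e → ¬ c ~ e → ⊥
  no-induced-P5 p5-free {a} {b} {c} {d} {e} ab bc cd de a≁c a≁d a≁e b≁d b≁e c≁e =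
    p5-free (induced {H = P 5} {G = G} twinFree-P5 path upper)
    where
    path : Fin 5 → Fin n
    path = lookup (a ∷ b ∷ c ∷ d ∷ e ∷ [])
    upper : ∀ {i j} → i < j → Realises (adj (P 5) i j) (adj G (path i) (path j))
    upper {0F} {1F} _ = ab
    upper {0F} {2F} _ = a≁c
    upper {0F} {3F} _ = a≁d
    upper {0F} {4F} _ = a≁e
    upper {1F} {2F} _ = bc
    upper {1F} {3F} _ = b≁d
    upper {1F} {4F} _ = b≁e
    upper {2F} {3F} _ = cd
    upper {2F} {4F} _ = c≁e
    upper {3F} {4F} _ = de
    upper {_} {0F} ()
    upper {suc _} {1F} (s≤s ())
    upper {suc (suc _)} {2F} (s≤s (s≤s ()))
    upper {suc (suc (suc _))} {3F} (s≤s (s≤s (s≤s ())))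
    upper {suc (suc (suc (suc _)))} {4F} (s≤s (s≤s (s≤s (s≤s ()))))

  no-induced-paw : Free Paw G → ∀ {p c t t'} → p ~ c → c ~ t → c ~ t' → t ~ t' →
    ¬ p ~ t → ¬ p ~ t' → ⊥
  no-induced-paw paw-free {p} {c} {t} {t'} pc ct ct' tt' p≁t p≁t' =
    paw-free (induced {H = Paw} {G = G} twinFree-Paw paw upper)
    where
    paw : Fin 4 → Fin n
    paw = lookup (p ∷ c ∷ t ∷ t' ∷ [])
    upper : ∀ {i j} → i < j → Realises (adj Paw i j) (adj G (paw i) (paw j))
    upper {0F} {1F} _ = pc
    upper {0F} {2F} _ = p≁t
    upper {0F} {3F} _ = p≁t'
    upper {1F} {2F} _ = ct
    upper {1F} {3F} _ = ct'
    upper {2F} {3F} _ = tt'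
    upper {_} {0F} ()
    upper {suc _} {1F} (s≤s ())
    upper {suc (suc _)} {2F} (s≤s (s≤s ()))
    upper {suc (suc (suc _))} {3F} (s≤s (s≤s (s≤s ())))

  adjacent-to-triangle : Free Paw G → ∀ {v t s s'} → t ~ s → t ~ s' → s ~ s' →
    v ~ t → ¬ v ~ s → v ~ s'
  adjacent-to-triangle paw-free {v} {s' = s'} ts ts' ss' vt v≁s with v ~? s'
  ... | yes vs' = vs'
  ... | no v≁s' = ⊥-elim (no-induced-paw paw-free vt ts ts' ss' v≁s v≁s')

  propagate : Connected G → (Q : Fin n → Set) → (∀ {u v} → Q u → u ~ v → Q v) →
    ∀ {u} → Q u → ∀ v → Q v
  propagate conn Q closed {u} Qu v = along (conn u v) Qu
    where
    along : ∀ {u v} → Walk G u v → Q u → Q v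
    along here           Qu = Qu
    along (step uw walk) Qu = along walk (closed Qu uw)

  N : Fin n → Subset n
  N v = tabulate (adj G v)

  ∈N⇔~ : ∀ {u v} → u ∈ N v ⇔ v ~ u
  ∈N⇔~ {u} {v} = mk⇔
    (λ u∈Nv → Bool.T-≡ .from (trans (≡.sym (lookup∘tabulate (adj G v) u)) ([]=⇒lookup u∈Nv)))
    (λ vu → lookup⇒[]= u (N v) (trans (lookup∘tabulate (adj G v) u) (Bool.T-≡ .to vu)))

  deg : Fin n → ℕ
  deg v = ∣ N v ∣

  private-neighbour : ∀ {x y w} → deg y ≤ deg x → y ~ w → ¬ x ~ w → ∃[ a ] x ~ a × ¬ y ~ a
  private-neighbour {x} {y} {w} y≤x yw x≁w with any? (λ a → x ~? a ×-dec ¬? (y ~? a))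
  ... | yes found = found
  ... | no none = ⊥-elim (≤⇒≯ y≤x (p⊂q⇒∣p∣<∣q∣ Nx⊂Ny))
    where
    Nx⊂Ny : N x ⊂ N y
    Nx⊂Ny = (λ {a} a∈Nx → ∈N⇔~ .from (y~a (∈N⇔~ .to a∈Nx))) ,
            w , ∈N⇔~ .from yw , x≁w ∘ ∈N⇔~ .to
      where
      y~a : ∀ {a} → x ~ a → y ~ a
      y~a {a} xa with y ~? a
      ... | yes ya = ya
      ... | no y≁a = ⊥-elim (none (a , xa , y≁a))

  cops₂ : Fin n → Fin n → Cops 2 n
  cops₂ a b 0F = a
  cops₂ a b 1F = b

  moves₂ : ∀ {a b a' b'} → Move G a a' → Move G b b' → CopsMove G (cops₂ a b) (cops₂ a' b')
  moves₂ aa' bb' 0F = aa'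
  moves₂ aa' bb' 1F = bb'

  stay : ∀ {a} → Move G a a
  stay = inj₁ refl

  capture : ∀ {a b r} → Move G a r ⊎ Move G b r → CopsForceWin G (cops₂ a b) r
  capture {b = b} {r} (inj₁ ar) = move (cops₂ r b) (moves₂ ar stay) (inj₁ (0F , refl))
  capture {a = a} {r = r} (inj₂ br) = move (cops₂ a r) (moves₂ stay br) (inj₁ (1F , refl))

  capture-next-round : ∀ {a b a' b' r} → Move G a a' → Move G b b' →
    (∀ {r'} → Move G r r' → Move G a' r' ⊎ Move G b' r') → CopsForceWin G (cops₂ a b) r
  capture-next-round {a' = a'} {b'} aa' bb' cover =
    move (cops₂ a' b') (moves₂ aa' bb') (inj₂ λ r' rr' → inj₂ (capture (cover rr')))

  dominating-pair-wins : ∀ a b → (∀ v → Move G a v ⊎ Move G b v) → CopsWin G 2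
  dominating-pair-wins a b dominates = cops₂ a b , λ r → inj₂ (capture (dominates r))

  triangle-dominated : Connected G → Free Paw G → ∀ {x a b} → x ~ a → x ~ b → a ~ b →
    ∀ v → Move G x v ⊎ Move G a v
  triangle-dominated conn paw-free {x} {a} {b} xa xb ab =
    near⇒dominated ∘ propagate conn Near closed (inj₁ stay)
    where
    spread : ∀ {v t s s'} → t ~ s → t ~ s' → s ~ s' → v ~ t → ¬ v ~ s → v ~ s'
    spread = adjacent-to-triangle paw-free
    Near : Fin n → Set
    Near v = Move G x v ⊎ (v ~ a × v ~ b)
    off-x : ∀ {v} → ¬ v ~ x → v ~ a ⊎ v ~ b → v ~ a × v ~ b
    off-x v≁x (inj₁ va) = va , spread (~-sym xa) ab xb va v≁x
    off-x v≁x (inj₂ vb) = spread (~-sym xb) (~-sym ab) xa vb v≁x , vb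
    closed : ∀ {u v} → Near u → u ~ v → Near v
    closed {u} {v} Nu uv with x ~? v
    ... | yes xv = inj₁ (inj₂ xv)
    ... | no x≁v = inj₂ (off-x v≁x (via Nu))
      where
      v≁x : ¬ v ~ x
      v≁x = ≁-sym x≁v
      vu : v ~ u
      vu = ~-sym uv
      via : Near u → v ~ a ⊎ v ~ b
      via (inj₁ (inj₁ refl)) = ⊥-elim (x≁v uv)
      via (inj₁ (inj₂ xu)) with u ~? a
      ... | yes ua = inj₁ (spread (~-sym xu) ua xa vu v≁x)
      ... | no u≁a = inj₂ (spread (~-sym xu) (spread xa xb ab (~-sym xu) u≁a) xb vu v≁x)
      via (inj₂ (ua , ub)) with v ~? a
      ... | yes va = inj₁ va
      ... | no v≁a = inj₂ (spread ua ub ab vu v≁a)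
    near⇒dominated : ∀ {v} → Near v → Move G x v ⊎ Move G a v
    near⇒dominated (inj₁ xv)       = inj₁ xv
    near⇒dominated (inj₂ (va , _)) = inj₂ (inj₂ (~-sym va))

  record InducedC5 : Set where
    field
      w           : Fin 5 → Fin n
      adjacent    : ∀ i → w i ~ w (i ⊕ 1)
      nonadjacent : ∀ i → ¬ w i ~ w (i ⊕ 2)

    w-period : ∀ i k → w (i ⊕ (5 + k)) ≡ w (i ⊕ k)
    w-period i k = cong w (⊕-period i k)

    adjacent⁻ : ∀ i → w i ~ w (i ⊕ 4)
    adjacent⁻ i = ~-sym (subst (w (i ⊕ 4) ~_) (w-period i 0) (adjacent (i ⊕ 4)))

    nonadjacent⁻ : ∀ i → ¬ w i ~ w (i ⊕ 3)
    nonadjacent⁻ i = ≁-sym (subst (λ v → ¬ w (i ⊕ 3) ~ v) (w-period i 0) (nonadjacent (i ⊕ 3)))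

    Straddles : Fin n → Set
    Straddles z = ∃[ i ] z ~ w i × z ~ w (i ⊕ 2)

  induced-C5 : ∀ {a b c d e} → a ~ b → b ~ c → c ~ d → d ~ e → e ~ a →
    ¬ a ~ c → ¬ b ~ d → ¬ c ~ e → ¬ d ~ a → ¬ e ~ b → InducedC5
  induced-C5 {a} {b} {c} {d} {e} ab bc cd de ea a≁c b≁d c≁e d≁a e≁b = record
    { w = cycle ; adjacent = adjacent ; nonadjacent = nonadjacent }
    where
    cycle : Fin 5 → Fin n
    cycle = lookup (a ∷ b ∷ c ∷ d ∷ e ∷ [])
    adjacent : ∀ i → cycle i ~ cycle (i ⊕ 1)
    adjacent 0F = ab
    adjacent 1F = bc
    adjacent 2F = cd
    adjacent 3F = de
    adjacent 4F = ea
    nonadjacent : ∀ i → ¬ cycle i ~ cycle (i ⊕ 2)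
    nonadjacent 0F = a≁c
    nonadjacent 1F = b≁d
    nonadjacent 2F = c≁e
    nonadjacent 3F = d≁a
    nonadjacent 4F = e≁b

  module _ (p5-free : Free (P 5) G) (triangle-free : TriangleFree) (C : InducedC5) where
    open InducedC5 C

    neighbour-of-C5 : ∀ {z} i → z ~ w i → z ~ w (i ⊕ 2) ⊎ z ~ w (i ⊕ 3)
    neighbour-of-C5 {z} i zw with z ~? w (i ⊕ 2) | z ~? w (i ⊕ 3)
    ... | yes z2 | _      = inj₁ z2
    ... | no _   | yes z3 = inj₂ z3
    ... | no z≁2 | no z≁3 = ⊥-elim (no-induced-P5 p5-free
          zw (adjacent i) (adjacent (i ⊕ 1)) (adjacent (i ⊕ 2))
          (triangle-free zw (adjacent i)) z≁2 z≁3 (nonadjacent i) (nonadjacent⁻ i) (nonadjacent (i ⊕ 1)))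

    straddles : ∀ {z} i → z ~ w i → Straddles z
    straddles {z} i zw with neighbour-of-C5 i zw
    ... | inj₁ z2 = i , zw , z2
    ... | inj₂ z3 = i ⊕ 3 , z3 , subst (z ~_) (≡.sym (w-period i 0)) zw

    neighbour-of-straddler : ∀ {z z'} i → z ~ w i → z ~ w (i ⊕ 2) → z' ~ z →
      z' ~ w (i ⊕ 2) ⊎ z' ~ w (i ⊕ 3) ⊎ z' ~ w (i ⊕ 4)
    neighbour-of-straddler {z} {z'} i z0 z2 z'z
      with z' ~? w (i ⊕ 2) | z' ~? w (i ⊕ 3) | z' ~? w (i ⊕ 4)
    ... | yes z'2 | _       | _       = inj₁ z'2
    ... | no _    | yes z'3 | _       = inj₂ (inj₁ z'3)
    ... | no _    | no _    | yes z'4 = inj₂ (inj₂ z'4)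
    ... | no z'≁2 | no z'≁3 | no z'≁4 = ⊥-elim (no-induced-P5 p5-free
          z'z z2 (adjacent (i ⊕ 2)) (adjacent (i ⊕ 3)) z'≁2 z'≁3 z'≁4
          (triangle-free z2 (adjacent (i ⊕ 2))) (triangle-free z0 (adjacent⁻ i)) (nonadjacent (i ⊕ 2)))

    all-straddle : Connected G → ∀ v → Straddles v
    all-straddle conn = propagate conn Straddles closed (straddles 1F (adjacent 0F))
      where
      closed : ∀ {u v} → Straddles u → u ~ v → Straddles v
      closed (i , u0 , u2) uv with neighbour-of-straddler i u0 u2 (~-sym uv)
      ... | inj₁ v~2        = straddles (i ⊕ 2) v~2
      ... | inj₂ (inj₁ v~3) = straddles (i ⊕ 3) v~3
      ... | inj₂ (inj₂ v~4) = straddles (i ⊕ 4) v~4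

    -- A straddler of w i, w (i+2) can only step to common neighbours of w (i+1)
    -- with w (i+3) or w (i+4).
    straddler-step : ∀ {z z'} i → z ~ w i → z ~ w (i ⊕ 2) → z ~ z' → z' ~ w (i ⊕ 1)
    straddler-step {z} {z'} i z0 z2 zz' with neighbour-of-straddler i z0 z2 (~-sym zz')
    ... | inj₁ z'2 = ⊥-elim (triangle-free zz' z'2 z2)
    ... | inj₂ (inj₁ z'3) with neighbour-of-C5 (i ⊕ 3) z'3
    ...   | inj₁ z'5 = ⊥-elim (triangle-free zz' (subst (z' ~_) (w-period i 0) z'5) z0)
    ...   | inj₂ z'6 = subst (z' ~_) (w-period i 1) z'6
    straddler-step {z} {z'} i z0 z2 zz' | inj₂ (inj₂ z'4) with neighbour-of-C5 (i ⊕ 4) z'4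
    ...   | inj₁ z'6 = subst (z' ~_) (w-period i 1) z'6
    ...   | inj₂ z'7 = ⊥-elim (triangle-free zz' (subst (z' ~_) (w-period i 2) z'7) z2)

    C5-two-cops : Connected G → CopsWin G 2
    C5-two-cops conn = cops₂ (w 0F) (w 2F) , λ r → inj₂ (catch (all-straddle conn r))
      where
      catch : ∀ {r} → Straddles r → CopsForceWin G (cops₂ (w 0F) (w 2F)) r
      catch (0F , r0 , _) = capture (inj₁ (inj₂ (~-sym r0)))
      catch (2F , r2 , _) = capture (inj₂ (inj₂ (~-sym r2)))
      catch (3F , _ , r0) = capture (inj₁ (inj₂ (~-sym r0)))
      catch (1F , r1 , r3) = capture-next-round (inj₂ (adjacent 0F)) stay cover
        where
        cover : ∀ {r'} → Move G _ r' → Move G (w 1F) r' ⊎ Move G (w 2F) r'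
        cover (inj₁ refl) = inj₁ (inj₂ (~-sym r1))
        cover (inj₂ rr')  = inj₂ (inj₂ (~-sym (straddler-step 1F r1 r3 rr')))
      catch (4F , r4 , r1) = capture-next-round stay (inj₂ (~-sym (adjacent 1F))) cover
        where
        cover : ∀ {r'} → Move G _ r' → Move G (w 0F) r' ⊎ Move G (w 1F) r'
        cover (inj₁ refl) = inj₂ (inj₂ (~-sym r1))
        cover (inj₂ rr')  = inj₁ (inj₂ (~-sym (straddler-step 4F r4 r1 rr')))

  module _ (conn : Connected G) (p5-free : Free (P 5) G) (triangle-free : TriangleFree) where

    module _ {x} (x-max : ∀ v → deg v ≤ deg x) where

      WithinTwo : Fin n → Set
      WithinTwo v = Move G x v ⊎ ∃[ a ] x ~ a × a ~ v

      within-two : ∀ v → WithinTwo v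
      within-two = propagate conn WithinTwo closed (inj₁ stay)
        where
        closed : ∀ {u v} → WithinTwo u → u ~ v → WithinTwo v
        closed {u} {v} Wu uv with x ≟ v | x ~? v | any? (λ a → x ~? a ×-dec a ~? v)
        ... | yes x≡v | _      | _        = inj₁ (inj₁ x≡v)
        ... | no _    | yes xv | _        = inj₁ (inj₂ xv)
        ... | no _    | no _   | yes path = inj₂ path
        ... | no _    | no x≁v | no far   = ⊥-elim (impossible Wu)
          where
          impossible : WithinTwo u → ⊥
          impossible (inj₁ (inj₁ refl)) = x≁v uv
          impossible (inj₁ (inj₂ xu))   = far (u , xu , uv)
          impossible (inj₂ (a , xa , au)) with x ~? u
          ... | yes xu = far (u , xu , uv)
          -- u has no more neighbours than x, so some neighbour a' of x misses u,
          -- and v u a x a' is an induced P5.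
          ... | no x≁u with private-neighbour (x-max u) uv x≁v
          ...   | a' , xa' , u≁a' = no-induced-P5 p5-free (~-sym uv) (~-sym au) (~-sym xa) xa'
                    (λ va → far (a , xa , ~-sym va)) (≁-sym x≁v) (λ va' → far (a' , xa' , ~-sym va'))
                    (≁-sym x≁u) u≁a' (triangle-free (~-sym xa) xa')

      outer-edge⇒C5 : ∀ {b c} → ¬ x ~ b → ¬ x ~ c → b ~ c → InducedC5
      outer-edge⇒C5 {b} {c} x≁b x≁c bc with within-two b
      ... | inj₁ (inj₁ refl) = ⊥-elim (x≁c bc)
      ... | inj₁ (inj₂ xb)   = ⊥-elim (x≁b xb)
      ... | inj₂ (a , xa , ab) with private-neighbour (x-max b) bc x≁c
      ...   | a' , xa' , b≁a' with c ~? a'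
      ...     | yes ca' = induced-C5 xa ab bc ca' (~-sym xa')
                  x≁b (triangle-free ab bc) b≁a' (≁-sym x≁c) (triangle-free (~-sym xa') xa)
      ...     | no c≁a' = ⊥-elim (no-induced-P5 p5-free (~-sym bc) (~-sym ab) (~-sym xa) xa'
                  (triangle-free ab bc ∘ ~-sym) (≁-sym x≁c) c≁a' (≁-sym x≁b) b≁a'
                  (triangle-free (~-sym xa) xa'))

      dominating-edge : (∀ {b c} → ¬ x ~ b → ¬ x ~ c → ¬ b ~ c) →
        ∀ {y} → x ~ y → (∀ a → x ~ a → deg a ≤ deg y) → ∀ v → Move G x v ⊎ Move G y v
      dominating-edge no-outer-edge {y} xy y-max v with within-two v
      ... | inj₁ xv = inj₁ xv
      ... | inj₂ (a , xa , av) with x ~? v | y ~? v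
      ...   | yes xv | _      = inj₁ (inj₂ xv)
      ...   | no _   | yes yv = inj₂ (inj₂ yv)
      ...   | no x≁v | no y≁v with private-neighbour (y-max a xa) av y≁v
      ...     | z , yz , a≁z = ⊥-elim (no-induced-P5 p5-free (~-sym av) (~-sym xa) xy yz
                (≁-sym x≁v) (≁-sym y≁v) (no-outer-edge x≁v x≁z) (triangle-free (~-sym xa) xy) a≁z x≁z)
        where
        x≁z : ¬ x ~ z
        x≁z = triangle-free xy yz

      max-degree-two-cops : CopsWin G 2
      max-degree-two-cops with any? (λ b → any? (λ c → ¬? (x ~? b) ×-dec ¬? (x ~? c) ×-dec b ~? c))
      ... | yes (b , c , x≁b , x≁c , bc) =
        C5-two-cops p5-free triangle-free (outer-edge⇒C5 x≁b x≁c bc) conn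
      ... | no no-outer-edge with any? (x ~?_)
      ...   | no isolated = dominating-pair-wins x x (λ v → only-x (within-two v))
        where
        only-x : ∀ {v} → WithinTwo v → Move G x v ⊎ Move G x v
        only-x (inj₁ xv)          = inj₁ xv
        only-x (inj₂ (a , xa , _)) = ⊥-elim (isolated (a , xa))
      ...   | yes (a , xa) with maximiser deg (x ~?_) xa
      ...     | y , xy , y-max = dominating-pair-wins x y
                  (dominating-edge (λ x≁b x≁c bc → no-outer-edge (_ , _ , x≁b , x≁c , bc)) xy y-max)

    triangle-free-two-cops : Fin n → CopsWin G 2
    triangle-free-two-cops v₀ with maximiser deg U? {v₀} tt
    ... | x , _ , x-max = max-degree-two-cops (λ v → x-max v tt)

  two-cops-win : Connected G → Free (P 5) G → Free Paw G → Fin n → CopsWin G 2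
  two-cops-win conn p5-free paw-free v₀
    with any? (λ x → any? (λ a → any? (λ b → x ~? a ×-dec x ~? b ×-dec a ~? b)))
  ... | yes (x , a , b , xa , xb , ab) =
    dominating-pair-wins x a (triangle-dominated conn paw-free xa xb ab)
  ... | no no-triangle =
    triangle-free-two-cops conn p5-free (λ ab bc ac → no-triangle (_ , _ , _ , ab , ac , bc)) v₀

lemma3p1 : ∀ {n} (G : Graph n) → Connected G → Free (P 5) G → Free Paw G →
    Σ ℕ λ k → k ≤ 2 × CopsWin G k
lemma3p1 {zero}  G conn p5-free paw-free = 0 , z≤n , (λ ()) , (λ ())
lemma3p1 {suc _} G conn p5-free paw-free = 2 , s≤s (s≤s z≤n) , two-cops-win G conn p5-free paw-free 0F
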